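{- Let $(a_n)_{n\ge 1}$, $(b_n)_{n\ge 1}$ and $(f_n)_{n\ge 1}$ be sequences of complex numbers, and let $(y_n)_{n\ge -1}$ be the sequence of complex numbers determined by given initial values $y_{ -1},y_0$ and the second order linear difference equation $$y_n-b_n y_{n-1}-a_n y_{n-2}=f_n,\qquad n\ge 1.$$ Assume that there exist sequences $(c_n)_{n\ge 1}$ and $(d_n)_{n\ge 1}$ of complex numbers satisfying $$c_n+d_{n+1}=b_n \quad\text{and}\quad c_n d_n=-a_n \qquad\text{for every } n\ge 1.$$ Then for every $n\ge 1$, $$y_{n}=\sum_{i=1}^{n+1} \left( \sum_{j=1}^{i-1} f_j \prod_{k=j+1}^{i-1} c_k+(y_0-d_1 y_{ -1})\prod_{k=1}^{i-1} c_k\right) \prod_{j=i+1}^{n+1} d_j +y_{ -1}\prod_{j=1}^{n+1} d_j .$$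
   Context: Empty sums are $0$ and empty products are $1$. -}

module Defs where

open import Level using (Level)
open import Data.Nat using (ℕ; zero; suc; _∸_)
import Data.Nat as ℕ
open import Data.List using (List; foldr; applyUpTo)
open import Algebra.Bundles using (CommutativeRing)

-- The integers lo, lo+1, ..., hi (empty when hi < lo).
range : ℕ → ℕ → List ℕ
range lo hi = applyUpTo (lo ℕ.+_) (suc hi ∸ lo)

module _ {c ℓ : Level} (R : CommutativeRing c ℓ) where
  open CommutativeRing R

  sumR : ℕ → ℕ → (ℕ → Carrier) → Carrier
  sumR lo hi g = foldr (λ i acc → g i + acc) 0# (range lo hi)

  prodR : ℕ → ℕ → (ℕ → Carrier) → Carrier
  prodR lo hi g = foldr (λ i acc → g i * acc) 1# (range lo hi)

  _−_ : Carrier → Carrier → Carrier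
  x − y = x + (- y)

  -- Sequence (y_n)_{n ≥ -1} given by y₋₁ and (y_n)_{n ≥ 0}:
  -- shiftY y₋₁ y m = y_{m-1}.
  shiftY : Carrier → (ℕ → Carrier) → ℕ → Carrier
  shiftY ym1 y zero    = ym1
  shiftY ym1 y (suc m) = y m

-- With b n = c n + d (n+1) and a n = - c n d n the difference operator factors into two first-order
-- ones: z n = y n - d (n+1) y (n-1) satisfies z n = f n + c n z (n-1), and conversely
-- y n = z n + d (n+1) y (n-1). Unrolling a first-order recurrence u m = g m + p m u (m-1) gives
-- u m = Σ_{j=1}^{m} g j Π_{k=j+1}^{m} p k + u 0 Π_{k=1}^{m} p k; doing this for z (with g = f, p = c)
-- and then for the shifted sequence y (n-1) (with g i = z (i-1), p = d) yields the formula,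
-- which in fact also holds for n = 0.
module Submission where

open import Defs
open import Level using (Level)
open import Data.Nat using (ℕ; zero; suc; _∸_; _≤_; _<_; _≥_; s≤s; z≤n)
import Data.Nat as ℕ
open import Data.Nat.Properties using (+-∸-assoc; m+[n∸m]≡n; n∸n≡0)
open import Data.List using ([]; _∷_; _∷ʳ_; foldr; applyUpTo)
open import Data.List.Properties using (applyUpTo-∷ʳ)
open import Data.List.Membership.Propositional using (_∈_)
open import Data.List.Membership.Propositional.Properties using (∈-applyUpTo⁻)
open import Data.List.Relation.Unary.Any using (here; there)
open import Data.Maybe using (nothing)
open import Data.Product using (_,_)
open import Algebra.Bundles using (Monoid; CommutativeRing)
open import Relation.Binary.PropositionalEquality as ≡ using (_≡_)
import Relation.Binary.Reasoning.Setoid as SetoidReasoning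
open import Tactic.RingSolver.Core.AlmostCommutativeRing using (fromCommutativeRing)
import Tactic.RingSolver.NonReflective as RingSolver
import Algebra.Solver.CommutativeMonoid

m<n∸o⇒o+m<n : ∀ {m} n o → m < n ∸ o → o ℕ.+ m < n
m<n∸o⇒o+m<n n       zero    m<n   = m<n
m<n∸o⇒o+m<n (suc n) (suc o) m<n∸o = s≤s (m<n∸o⇒o+m<n n o m<n∸o)

∈-range⇒≤ : ∀ {i} lo hi → i ∈ range lo hi → i ≤ hi
∈-range⇒≤ lo hi i∈ with ∈-applyUpTo⁻ (lo ℕ.+_) i∈
... | j , j< , ≡.refl with m<n∸o⇒o+m<n (suc hi) lo j<
... | s≤s lo+j≤hi = lo+j≤hi

range-suc : ∀ {lo} hi → lo ≤ suc hi → range lo (suc hi) ≡ range lo hi ∷ʳ suc hi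
range-suc {lo} hi lo≤1+hi = begin
  applyUpTo (lo ℕ.+_) (suc (suc hi) ∸ lo)      ≡⟨ ≡.cong (applyUpTo (lo ℕ.+_)) (+-∸-assoc 1 lo≤1+hi) ⟩
  applyUpTo (lo ℕ.+_) (suc (suc hi ∸ lo))      ≡⟨ applyUpTo-∷ʳ (lo ℕ.+_) (suc hi ∸ lo) ⟨
  range lo hi ∷ʳ (lo ℕ.+ (suc hi ∸ lo))        ≡⟨ ≡.cong (range lo hi ∷ʳ_) (m+[n∸m]≡n lo≤1+hi) ⟩
  range lo hi ∷ʳ suc hi                          ∎
  where open ≡.≡-Reasoning

range-suc-empty : ∀ n → range (suc n) n ≡ []
range-suc-empty n = ≡.cong (applyUpTo (suc n ℕ.+_)) (n∸n≡0 n)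

module _ {c ℓ : Level} (M : Monoid c ℓ) where
  open Monoid M

  foldr-map-∷ʳ : ∀ (g : ℕ → Carrier) xs x →
    foldr (λ i acc → g i ∙ acc) ε (xs ∷ʳ x) ≈ foldr (λ i acc → g i ∙ acc) ε xs ∙ g x
  foldr-map-∷ʳ g []       x = trans (identityʳ (g x)) (sym (identityˡ (g x)))
  foldr-map-∷ʳ g (y ∷ xs) x = trans (∙-congˡ (foldr-map-∷ʳ g xs x)) (sym (assoc _ _ _))

module _ {c ℓ : Level} (R : CommutativeRing c ℓ) where
  open CommutativeRing R
  open SetoidReasoning setoid

  sumR-suc : ∀ lo hi (g : ℕ → Carrier) → lo ≤ suc hi → sumR R lo (suc hi) g ≈ sumR R lo hi g + g (suc hi)
  sumR-suc lo hi g lo≤1+hi =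
    trans (reflexive (≡.cong (foldr (λ i acc → g i + acc) 0#) (range-suc hi lo≤1+hi)))
          (foldr-map-∷ʳ +-monoid g (range lo hi) (suc hi))

  prodR-suc : ∀ lo hi (g : ℕ → Carrier) → lo ≤ suc hi → prodR R lo (suc hi) g ≈ prodR R lo hi g * g (suc hi)
  prodR-suc lo hi g lo≤1+hi =
    trans (reflexive (≡.cong (foldr (λ i acc → g i * acc) 1#) (range-suc hi lo≤1+hi)))
          (foldr-map-∷ʳ *-monoid g (range lo hi) (suc hi))

  prodR-suc-empty : ∀ n (g : ℕ → Carrier) → prodR R (suc n) n g ≈ 1#
  prodR-suc-empty n g = reflexive (≡.cong (foldr (λ i acc → g i * acc) 1#) (range-suc-empty n))

  sumR-cong : ∀ lo hi {g h} → (∀ i → i ∈ range lo hi → g i ≈ h i) → sumR R lo hi g ≈ sumR R lo hi h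
  sumR-cong lo hi {g} {h} = go (range lo hi)
    where
    go : ∀ xs → (∀ i → i ∈ xs → g i ≈ h i) →
         foldr (λ i acc → g i + acc) 0# xs ≈ foldr (λ i acc → h i + acc) 0# xs
    go []       _   = refl
    go (x ∷ xs) g≈h = +-cong (g≈h x (here ≡.refl)) (go xs (λ i i∈ → g≈h i (there i∈)))

  sumR-distribʳ : ∀ lo hi (g : ℕ → Carrier) x → sumR R lo hi (λ i → g i * x) ≈ sumR R lo hi g * x
  sumR-distribʳ lo hi g x = go (range lo hi)
    where
    go : ∀ xs → foldr (λ i acc → g i * x + acc) 0# xs ≈ foldr (λ i acc → g i + acc) 0# xs * x
    go []       = sym (zeroˡ x)
    go (y ∷ xs) = trans (+-congˡ (go xs)) (sym (distribʳ x (g y) _))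

  sumR-prodR-suc : ∀ lo hi (g p : ℕ → Carrier) → lo ≤ suc hi →
    sumR R lo (suc hi) (λ j → g j * prodR R (suc j) (suc hi) p)
      ≈ sumR R lo hi (λ j → g j * prodR R (suc j) hi p) * p (suc hi) + g (suc hi)
  sumR-prodR-suc lo hi g p lo≤1+hi = begin
    sumR R lo (suc hi) (λ j → g j * prodR R (suc j) (suc hi) p)
      ≈⟨ sumR-suc lo hi (λ j → g j * prodR R (suc j) (suc hi) p) lo≤1+hi ⟩
    sumR R lo hi (λ j → g j * prodR R (suc j) (suc hi) p) + g (suc hi) * prodR R (suc (suc hi)) (suc hi) p
      ≈⟨ +-cong (sumR-cong lo hi peel-last) (trans (*-congˡ (prodR-suc-empty (suc hi) p)) (*-identityʳ _)) ⟩
    sumR R lo hi (λ j → g j * prodR R (suc j) hi p * p (suc hi)) + g (suc hi)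
      ≈⟨ +-congʳ (sumR-distribʳ lo hi (λ j → g j * prodR R (suc j) hi p) (p (suc hi))) ⟩
    sumR R lo hi (λ j → g j * prodR R (suc j) hi p) * p (suc hi) + g (suc hi) ∎
    where
    peel-last : ∀ j → j ∈ range lo hi → g j * prodR R (suc j) (suc hi) p ≈ g j * prodR R (suc j) hi p * p (suc hi)
    peel-last j j∈ =
      trans (*-congˡ (prodR-suc (suc j) hi p (s≤s (∈-range⇒≤ lo hi j∈)))) (sym (*-assoc (g j) _ (p (suc hi))))

  linear-recurrence-solution : (u g p : ℕ → Carrier) →
    (∀ m → u (suc m) ≈ g (suc m) + p (suc m) * u m) →
    ∀ m → u m ≈ sumR R 1 m (λ j → g j * prodR R (suc j) m p) + u 0 * prodR R 1 m p
  linear-recurrence-solution u g p step zero = sym (trans (+-identityˡ _) (*-identityʳ _))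
  linear-recurrence-solution u g p step (suc m) = begin
    u (suc m)                ≈⟨ step m ⟩
    g (suc m) + p (suc m) * u m
      ≈⟨ +-congˡ (*-congˡ (linear-recurrence-solution u g p step m)) ⟩
    g (suc m) + p (suc m) * (S + u 0 * P)
      ≈⟨ solve 5 (λ g p S u P → (g ⊕ p ⊗ (S ⊕ u ⊗ P)) ⊜ ((S ⊗ p ⊕ g) ⊕ u ⊗ (P ⊗ p)))
               refl (g (suc m)) (p (suc m)) S (u 0) P ⟩
    (S * p (suc m) + g (suc m)) + u 0 * (P * p (suc m))
      ≈⟨ +-cong (sumR-prodR-suc 1 m g p (s≤s z≤n)) (*-congˡ (prodR-suc 1 m p (s≤s z≤n))) ⟨
    sumR R 1 (suc m) (λ j → g j * prodR R (suc j) (suc m) p) + u 0 * prodR R 1 (suc m) p ∎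
    where
    open RingSolver (fromCommutativeRing R (λ _ → nothing)) using (solve; _⊜_; _⊕_; _⊗_)
    S = sumR R 1 m (λ j → g j * prodR R (suc j) m p)
    P = prodR R 1 m p

  -- The ring solver cannot cancel x - x here (over an abstract ring its coefficients -1# + 1# do not
  -- normalise), so the cancelling pairs are inserted by hand and only rearranged by the monoid solver.
  second-order-factorisation : ∀ {y₂ y₁ y₀ a b c d d′ f} →
    y₂ - b * y₁ - a * y₀ ≈ f → c + d′ ≈ b → c * d ≈ - a →
    y₂ - d′ * y₁ ≈ f + c * (y₁ - d * y₀)
  second-order-factorisation {y₂} {y₁} {y₀} {a} {b} {c} {d} {d′} {f} recurrence c+d′≈b cd≈-a = begin
    y₂ - d′ * y₁
      ≈⟨ +-identityʳ _ ⟨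
    (y₂ - d′ * y₁) + 0#
      ≈⟨ +-congˡ (trans (+-cong (-‿inverseʳ cy₁) (-‿inverseʳ cdy₀)) (+-identityʳ 0#)) ⟨
    (y₂ - d′ * y₁) + ((cy₁ - cy₁) + (cdy₀ - cdy₀))
      ≈⟨ CM.solve 6 (λ y₂ -d′y₁ cy₁ -cy₁ cdy₀ -cdy₀ →
                      ((y₂ ⊕ -d′y₁) ⊕ ((cy₁ ⊕ -cy₁) ⊕ (cdy₀ ⊕ -cdy₀)))
                   ⊜ (((y₂ ⊕ (-cy₁ ⊕ -d′y₁)) ⊕ cdy₀) ⊕ (cy₁ ⊕ -cdy₀)))
                   refl y₂ (- (d′ * y₁)) cy₁ (- cy₁) cdy₀ (- cdy₀) ⟩
    ((y₂ + (- cy₁ + - (d′ * y₁))) + cdy₀) + (cy₁ - cdy₀)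
      ≈⟨ +-cong (+-cong (+-congˡ -by₁≈) -ay₀≈) c[y₁-dy₀]≈ ⟨
    (y₂ - b * y₁ - a * y₀) + c * (y₁ - d * y₀)
      ≈⟨ +-congʳ recurrence ⟩
    f + c * (y₁ - d * y₀) ∎
    where
    open import Algebra.Properties.Ring ring using (-‿involutive; -‿+-comm; -‿distribˡ-*; -‿distribʳ-*)
    module CM = Algebra.Solver.CommutativeMonoid +-commutativeMonoid
    open CM using (_⊕_; _⊜_)
    cy₁ = c * y₁
    cdy₀ = c * (d * y₀)
    -by₁≈ : - (b * y₁) ≈ - cy₁ + - (d′ * y₁)
    -by₁≈ = trans (-‿cong (trans (*-congʳ (sym c+d′≈b)) (distribʳ y₁ c d′))) (sym (-‿+-comm cy₁ (d′ * y₁)))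
    -ay₀≈ : - (a * y₀) ≈ cdy₀
    -ay₀≈ = begin
      - (a * y₀)      ≈⟨ -‿distribˡ-* a y₀ ⟩
      - a * y₀        ≈⟨ *-congʳ cd≈-a ⟨
      c * d * y₀      ≈⟨ *-assoc c d y₀ ⟩
      cdy₀            ∎
    c[y₁-dy₀]≈ : c * (y₁ - d * y₀) ≈ cy₁ - cdy₀
    c[y₁-dy₀]≈ = trans (distribˡ c y₁ _) (+-congˡ (sym (-‿distribʳ-* c (d * y₀))))

theorem1p1 : {c ℓ : Level} (R : CommutativeRing c ℓ) →
    let open CommutativeRing R in
    (a b f c d : ℕ → Carrier) (ym1 : Carrier) (y : ℕ → Carrier) →
    (∀ n → n ≥ 1 → _−_ R (_−_ R (y n) (b n * shiftY R ym1 y n)) (a n * shiftY R ym1 y (n ∸ 1)) ≈ f n) →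
    (∀ n → n ≥ 1 → c n + d (suc n) ≈ b n) →
    (∀ n → n ≥ 1 → c n * d n ≈ - a n) →
    ∀ n → n ≥ 1 →
      y n ≈ sumR R 1 (suc n) (λ i →
                (sumR R 1 (i ∸ 1) (λ j → f j * prodR R (suc j) (i ∸ 1) c)
                  + _−_ R (y 0) (d 1 * ym1) * prodR R 1 (i ∸ 1) c)
                * prodR R (suc i) (suc n) d)
            + ym1 * prodR R 1 (suc n) d
theorem1p1 R a b f c d ym1 y recurrence c+d′≈b cd≈-a n _ =
  trans (linear-recurrence-solution R w (λ i → z (i ∸ 1)) d w-step (suc n))
        (+-congʳ (sumR-cong R 1 (suc n) λ i _ → *-congʳ (z-solution (i ∸ 1))))
  where
  open CommutativeRing R
  w : ℕ → Carrier
  w = shiftY R ym1 y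
  z : ℕ → Carrier
  z m = y m - d (suc m) * w m
  z-solution : ∀ m → z m ≈ sumR R 1 m (λ j → f j * prodR R (suc j) m c) + z 0 * prodR R 1 m c
  z-solution = linear-recurrence-solution R z f c λ m →
    second-order-factorisation R (recurrence (suc m) (s≤s z≤n)) (c+d′≈b (suc m) (s≤s z≤n)) (cd≈-a (suc m) (s≤s z≤n))
  w-step : ∀ m → w (suc m) ≈ z m + d (suc m) * w m
  w-step m = sym (trans (+-assoc _ _ _) (trans (+-congˡ (-‿inverseˡ _)) (+-identityʳ _)))
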